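{- The Petersen graph is uniformly vertex-transitive but is not a Cayley graph.
   Context: The Petersen graph has as vertices the 2-element subsets of $\{1,2,3,4,5\}$, two being adjacent iff disjoint. For a finite group $G$ and $S\subset G$, the Cayley graph $C(G,S)$ has vertex set $G$, with $a,b$ adjacent iff $a=sb$ or $b=sa$ for some $s\in S$; a graph is Cayley if isomorphic to some $C(G,S)$. Automorphisms of a graph on $n$ vertices are identified with $n\times n$ permutation matrices (entry $(u,v)$ is $1$ iff $\sigma(u)=v$); $J_n$ is the all-ones matrix. A graph $\Gamma$ on $n$ vertices is uniformly vertex-transitive if there is a subset $\{\sigma_1,\ldots,\sigma_n\}\subset\mathrm{Aut}(\Gamma)$ of size $n$ with $\sum_i\sigma_i=J_n$. -}

module Defs where

open import Data.Nat using (ℕ; zero; suc; _+_)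
import Data.Nat.Properties as ℕP
open import Data.Bool using (if_then_else_)
import Data.Bool as B
open import Data.Fin using (Fin)
open import Data.Fin.Subset using (Subset; ∣_∣; _∩_; ⊥; _∈_)
open import Data.Vec.Properties using () renaming (≡-dec to vec-≡-dec)
open import Data.Product using (Σ; ∃; ∃-syntax; _×_; _,_; proj₁)
import Data.Product.Properties as ΣP
open import Relation.Binary.PropositionalEquality using (_≡_; _≢_)
open import Relation.Binary.Definitions using (DecidableEquality)
open import Relation.Nullary using (yes; no)
open import Relation.Nullary.Decidable using (⌊_⌋)
open import Function.Bundles using (_↔_; Inverse; _⇔_)
open import Algebra.Structures using (IsGroup)
open import Data.Sum using (_⊎_)

record Graph : Set₁ where
  field
    Vertex : Set
    Adj    : Vertex → Vertex → Set

open Graph public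

_≅_ : Graph → Graph → Set
Γ ≅ Δ = Σ (Vertex Γ ↔ Vertex Δ) λ f →
          ∀ u v → (Adj Γ u v ⇔ Adj Δ (Inverse.to f u) (Inverse.to f v))

PVertex : Set
PVertex = Σ (Subset 5) λ A → ∣ A ∣ ≡ 2

Petersen : Graph
Petersen = record
  { Vertex = PVertex
  ; Adj    = λ A B → proj₁ A ∩ proj₁ B ≡ ⊥
  }

_≟V_ : DecidableEquality PVertex
_≟V_ = ΣP.≡-dec (vec-≡-dec B._≟_) (λ p q → yes (ℕP.≡-irrelevant p q))

-- Finite groups (up to isomorphism every finite group has carrier Fin n).

record FinGroup : Set where
  field
    order   : ℕ
    _∙_     : Fin order → Fin order → Fin order
    ε       : Fin order
    _⁻¹     : Fin order → Fin order
    isGroup : IsGroup _≡_ _∙_ ε _⁻¹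

open FinGroup public

Cayley : (G : FinGroup) → Subset (order G) → Graph
Cayley G S = record
  { Vertex = Fin (order G)
  ; Adj    = λ a b → ∃[ s ] (s ∈ S × (a ≡ (_∙_ G) s b ⊎ b ≡ (_∙_ G) s a))
  }

IsCayleyGraph : Graph → Set
IsCayleyGraph Γ = ∃[ G ] ∃[ S ] (Γ ≅ Cayley G S)

Aut : Graph → Set
Aut Γ = Γ ≅ Γ

permMatrix : Aut Petersen → PVertex → PVertex → ℕ
permMatrix σ u v = if ⌊ Inverse.to (proj₁ σ) u ≟V v ⌋ then 1 else 0

sumMat : ∀ {n} → (Fin n → PVertex → PVertex → ℕ) → PVertex → PVertex → ℕ
sumMat {zero}  M u v = 0
sumMat {suc n} M u v = M Fin.zero u v + sumMat (λ i → M (Fin.suc i)) u v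
  where import Data.Fin as Fin

Jmat : PVertex → PVertex → ℕ
Jmat u v = 1

-- Petersen is uniformly vertex-transitive: 10 (= number of vertices)
-- pairwise distinct automorphisms whose permutation matrices sum to J.
PetersenUniformlyVT : Set
PetersenUniformlyVT =
  Σ (Fin 10 → Aut Petersen) λ σ → ( (∀ (i j : Fin 10) → i ≢ j → permMatrix (σ i) ≢ permMatrix (σ j))
         × (∀ u v → sumMat {10} (λ i → permMatrix (σ i)) u v ≡ Jmat u v))

module Submission where

-- P is loopless and cubic, two distinct vertices have at most one
-- common neighbour, and two distinct non-adjacent vertices have one (checked
-- exhaustively over the subsets of {0,…,4}).  These properties transfer along an
-- isomorphism P ≅ C(G,S).  In C(G,S) right multiplication is an automorphism,
-- so inversion permutes the three neighbours of the identity e and fixes one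
-- of them, t, giving t² = e.  For another neighbour p of e, right
-- multiplication by t swaps p and q = p·t, so it sends a common neighbour z of
-- p and q to a second common neighbour z·t ≠ z, which is impossible.
--
-- Every permutation π of {0,…,4} induces the
-- automorphism A ↦ π[A] of P, since relabelling preserves size and
-- disjointness.  The ten affine maps x ↦ x + b and x ↦ 2x + b of ℤ/5 send each
-- vertex to each vertex exactly once, so their permutation matrices sum to J
-- (a finite check); matrices summing to J are automatically pairwise distinct.

open import Defs
open import Level using (0ℓ)
open import Data.Nat using (ℕ; _+_; _*_; _≤_)
import Data.Nat as ℕ
open import Data.Nat.Properties
  using (≡-irrelevant; ≤-trans; m≤m+n; m≤n+m; +-monoʳ-≤; +-comm; 1+n≰n; +-0-commutativeMonoid)
open import Data.Nat.DivMod using (_mod_)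
open import Data.Bool using (Bool; true; false; _∧_; if_then_else_)
import Data.Bool as Bool
open import Data.Fin using (Fin; zero; suc; toℕ; quotient; remainder)
import Data.Fin as Fin
open import Data.Fin.Properties using (all?)
open import Data.Fin.Subset using (Subset; _∩_; ⊥; ∣_∣)
open import Data.Fin.Subset.Properties using (anySubset?)
open import Data.Fin.Permutation using (Permutation′; permutation; _⟨$⟩ʳ_; _⟨$⟩ˡ_; flip; inverseˡ)
open import Data.Vec using (Vec; []; _∷_; lookup; tabulate)
open import Data.Vec.Properties
  using (lookup∘tabulate; tabulate∘lookup; tabulate-cong; lookup-zipWith; lookup-replicate)
  renaming (≡-dec to vec-≡-dec)
open import Data.Vec.Functional using (rearrange)
open import Algebra.Properties.CommutativeMonoid.Sum +-0-commutativeMonoid using (sum; sum-permute; sum-cong-≗)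
open import Data.Product using (_×_; Σ; ∃; ∃-syntax; _,_; proj₁; proj₂)
open import Data.Sum using (_⊎_; inj₁; inj₂)
open import Data.Empty using () renaming (⊥ to Empty; ⊥-elim to ⊥-elim)
open import Relation.Nullary using (¬_; Dec; yes; no; ¬?)
open import Relation.Nullary.Decidable
  using (from-yes; dec-yes; ⌊_⌋; map′; _×-dec_; _→-dec_; _⊎-dec_; decidable-stable)
open import Relation.Binary.PropositionalEquality
open import Function using (_∘_)
open import Function.Bundles using (Inverse; Equivalence; mk⇔; mk↔ₛ′)
open import Algebra.Bundles using (Group)
open import Algebra.Structures using (IsGroup)
import Algebra.Properties.Group as GroupProperties

Loopless : Graph → Set
Loopless Γ = ∀ x → ¬ Adj Γ x x

AtMostOneCommonNeighbour : Graph → Set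
AtMostOneCommonNeighbour Γ = ∀ {u v z z′} → u ≢ v →
  Adj Γ u z → Adj Γ v z → Adj Γ u z′ → Adj Γ v z′ → z ≡ z′

NonAdjacentHaveCommonNeighbour : Graph → Set
NonAdjacentHaveCommonNeighbour Γ = ∀ {u v} → u ≢ v → ¬ Adj Γ u v →
  ∃[ z ] (Adj Γ u z × Adj Γ v z)

OneOf3 : {A : Set} → A → A → A → A → Set
OneOf3 a b c x = x ≡ a ⊎ x ≡ b ⊎ x ≡ c

record ThreeNeighbours (Γ : Graph) (x : Vertex Γ) : Set where
  constructor threeNeighbours
  field
    n₁ n₂ n₃  : Vertex Γ
    n₁≢n₂     : n₁ ≢ n₂
    n₁≢n₃     : n₁ ≢ n₃
    n₂≢n₃     : n₂ ≢ n₃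
    adj₁      : Adj Γ x n₁
    adj₂      : Adj Γ x n₂
    adj₃      : Adj Γ x n₃
    complete  : ∀ {w} → Adj Γ x w → OneOf3 n₁ n₂ n₃ w

Cubic : Graph → Set
Cubic Γ = ∀ x → ThreeNeighbours Γ x

record PetersenLike (Γ : Graph) : Set where
  field
    loopless  : Loopless Γ
    atMostOne : AtMostOneCommonNeighbour Γ
    common    : NonAdjacentHaveCommonNeighbour Γ
    cubic     : Cubic Γ

module Transport {Γ Δ : Graph} (iso : Γ ≅ Δ) where
  private
    to : Vertex Γ → Vertex Δ
    to = Inverse.to (proj₁ iso)
    from : Vertex Δ → Vertex Γ
    from = Inverse.from (proj₁ iso)
    to∘from : ∀ a → to (from a) ≡ a
    to∘from = Inverse.strictlyInverseˡ (proj₁ iso)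
    from∘to : ∀ x → from (to x) ≡ x
    from∘to = Inverse.strictlyInverseʳ (proj₁ iso)

    from-injective : ∀ {a b} → from a ≡ from b → a ≡ b
    from-injective {a} {b} eq = trans (sym (to∘from a)) (trans (cong to eq) (to∘from b))

    to-injective : ∀ {x y} → to x ≡ to y → x ≡ y
    to-injective {x} {y} eq = trans (sym (from∘to x)) (trans (cong from eq) (from∘to y))

    reflect : ∀ {a b} → Adj Δ a b → Adj Γ (from a) (from b)
    reflect {a} {b} p = Equivalence.from (proj₂ iso (from a) (from b))
      (subst₂ (Adj Δ) (sym (to∘from a)) (sym (to∘from b)) p)

    preserve : ∀ {a x} → Adj Γ (from a) x → Adj Δ a (to x)
    preserve {a} {x} p =
      subst (λ b → Adj Δ b (to x)) (to∘from a) (Equivalence.to (proj₂ iso (from a) x) p)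

  petersenLike : PetersenLike Γ → PetersenLike Δ
  petersenLike P = record
    { loopless  = λ a p → loopless (from a) (reflect p)
    ; atMostOne = λ u≢v uz vz uz′ vz′ → from-injective
        (atMostOne (λ eq → u≢v (from-injective eq)) (reflect uz) (reflect vz) (reflect uz′) (reflect vz′))
    ; common    = transportCommon
    ; cubic     = transportCubic
    }
    where
    open PetersenLike P

    transportCommon : NonAdjacentHaveCommonNeighbour Δ
    transportCommon {u} {v} u≢v ¬uv
      with common (λ eq → u≢v (from-injective eq))
                  (λ p → ¬uv (subst (Adj Δ u) (to∘from v) (preserve p)))
    ... | z , uz , vz = to z , preserve uz , preserve vz

    transportCubic : Cubic Δ
    transportCubic a = record
      { n₁ = to n₁ ; n₂ = to n₂ ; n₃ = to n₃
      ; n₁≢n₂ = λ eq → n₁≢n₂ (to-injective eq)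
      ; n₁≢n₃ = λ eq → n₁≢n₃ (to-injective eq)
      ; n₂≢n₃ = λ eq → n₂≢n₃ (to-injective eq)
      ; adj₁ = preserve adj₁ ; adj₂ = preserve adj₂ ; adj₃ = preserve adj₃
      ; complete = λ {w} p → back w (complete (reflect p))
      }
      where
      open ThreeNeighbours (cubic (from a))
      back : ∀ w → OneOf3 n₁ n₂ n₃ (from w) → OneOf3 (to n₁) (to n₂) (to n₃) w
      back w (inj₁ eq)        = inj₁ (trans (sym (to∘from w)) (cong to eq))
      back w (inj₂ (inj₁ eq)) = inj₂ (inj₁ (trans (sym (to∘from w)) (cong to eq)))
      back w (inj₂ (inj₂ eq)) = inj₂ (inj₂ (trans (sym (to∘from w)) (cong to eq)))

involution-swap : {A : Set} {f : A → A} → (∀ x → f (f x) ≡ x) → ∀ {x y} → f x ≡ y → f y ≡ x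
involution-swap invol {x} refl = invol x

-- An involution mapping a three-element set into itself fixes one of its
-- points, since an odd number of points cannot be paired off.
involution-fixes-one-of-three : {A : Set} (f : A → A) → (∀ x → f (f x) ≡ x) →
  {a b c : A} → a ≢ b → a ≢ c → b ≢ c →
  OneOf3 a b c (f a) → OneOf3 a b c (f b) → OneOf3 a b c (f c) →
  ∃[ x ] (OneOf3 a b c x × f x ≡ x)
involution-fixes-one-of-three f invol _ _ _ (inj₁ fa≡a) _ _ = _ , inj₁ refl , fa≡a
involution-fixes-one-of-three f invol _ _ b≢c (inj₂ (inj₁ fa≡b)) _ (inj₁ fc≡a) =
  ⊥-elim (b≢c (trans (sym fa≡b) (involution-swap invol fc≡a)))
involution-fixes-one-of-three f invol _ a≢c _ (inj₂ (inj₁ fa≡b)) _ (inj₂ (inj₁ fc≡b)) =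
  ⊥-elim (a≢c (trans (sym (involution-swap invol fa≡b)) (involution-swap invol fc≡b)))
involution-fixes-one-of-three f invol _ _ _ (inj₂ (inj₁ _)) _ (inj₂ (inj₂ fc≡c)) = _ , inj₂ (inj₂ refl) , fc≡c
involution-fixes-one-of-three f invol _ _ b≢c (inj₂ (inj₂ fa≡c)) (inj₁ fb≡a) _ =
  ⊥-elim (b≢c (trans (sym (involution-swap invol fb≡a)) fa≡c))
involution-fixes-one-of-three f invol _ _ _ (inj₂ (inj₂ _)) (inj₂ (inj₁ fb≡b)) _ = _ , inj₂ (inj₁ refl) , fb≡b
involution-fixes-one-of-three f invol a≢b _ _ (inj₂ (inj₂ fa≡c)) (inj₂ (inj₂ fb≡c)) _ =
  ⊥-elim (a≢b (trans (sym (involution-swap invol fa≡c)) (involution-swap invol fb≡c)))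

-- Cayley graphs C(G,S): right multiplication is an automorphism, which
-- forces the neighbourhood of the identity to be closed under inversion.
module CayleyGraph (G : FinGroup) (S : Subset (order G)) where
  private
    Element : Set
    Element = Fin (order G)
    C : Graph
    C = Cayley G S
    _·_ : Element → Element → Element
    _·_ = _∙_ G
    e : Element
    e = ε G
    inv : Element → Element
    inv = _⁻¹ G
    module 𝔾 = IsGroup (isGroup G)
    group : Group 0ℓ 0ℓ
    group = record { isGroup = isGroup G }
    open GroupProperties group using (⁻¹-involutive; ∙-cancelˡ)

  symmetric : ∀ {a b} → Adj C a b → Adj C b a
  symmetric (s , s∈S , inj₁ eq) = s , s∈S , inj₂ eq
  symmetric (s , s∈S , inj₂ eq) = s , s∈S , inj₁ eq

  right-multiply : ∀ {a b} k → Adj C a b → Adj C (a · k) (b · k)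
  right-multiply {b = b} k (s , s∈S , inj₁ eq) = s , s∈S , inj₁ (trans (cong (_· k) eq) (𝔾.assoc s b k))
  right-multiply {a = a} k (s , s∈S , inj₂ eq) = s , s∈S , inj₂ (trans (cong (_· k) eq) (𝔾.assoc s a k))

  inverse-neighbour : ∀ {x} → Adj C e x → Adj C e (inv x)
  inverse-neighbour {x} p =
    symmetric (subst₂ (Adj C) (𝔾.identityˡ (inv x)) (𝔾.inverseʳ x) (right-multiply (inv x) p))

  -- A neighbour t of e with t² = e and a second neighbour p of e lead to a
  -- contradiction: right multiplication by t swaps p and q = p·t, so it maps
  -- a common neighbour z of p and q to another one, z·t ≠ z.
  no-involutive-neighbour : Loopless C → AtMostOneCommonNeighbour C → NonAdjacentHaveCommonNeighbour C →
    ∀ {t p} → Adj C e t → t · t ≡ e → Adj C e p → p ≢ t → Empty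
  no-involutive-neighbour loopless unique common {t} {p} et tt≡e ep p≢t = t≢e (cancel (proj₂ fixed-point))
    where
    q : Element
    q = p · t
    t≢e : t ≢ e
    t≢e eq = loopless e (subst (Adj C e) eq et)
    cancel : ∀ {z} → z · t ≡ z → t ≡ e
    cancel {z} eq = ∙-cancelˡ z t e (trans eq (sym (𝔾.identityʳ z)))
    qt≡p : q · t ≡ p
    qt≡p = trans (𝔾.assoc p t t) (trans (cong (p ·_) tt≡e) (𝔾.identityʳ p))
    tq : Adj C t q
    tq = subst (λ w → Adj C w q) (𝔾.identityˡ t) (right-multiply t ep)
    e≢q : e ≢ q
    e≢q eq = p≢t (trans (sym qt≡p) (trans (cong (_· t) (sym eq)) (𝔾.identityˡ t)))
    p≢q : p ≢ q
    p≢q eq = t≢e (cancel (sym eq))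
    ¬pq : ¬ Adj C p q
    ¬pq pq = p≢t (unique e≢q ep (symmetric pq) et (symmetric tq))
    fixed-point : ∃[ z ] (z · t ≡ z)
    fixed-point with common p≢q ¬pq
    ... | z , pz , qz = z , sym (unique p≢q pz qz pz·t qz·t)
      where
      qz·t : Adj C q (z · t)
      qz·t = right-multiply t pz
      pz·t : Adj C p (z · t)
      pz·t = subst (λ w → Adj C w (z · t)) qt≡p (right-multiply t qz)

  -- No Cayley graph is Petersen-like: inversion is an involution of the
  -- three-element neighbourhood of e, so it fixes some neighbour t, i.e. t² = e.
  not-petersenLike : PetersenLike C → Empty
  not-petersenLike P = no-involutive-neighbour loopless atMostOne common (neighbour t∈N) t²≡e ep p≢t
    where
    open PetersenLike P
    open ThreeNeighbours (cubic e)

    neighbour : ∀ {x} → OneOf3 n₁ n₂ n₃ x → Adj C e x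
    neighbour (inj₁ refl)        = adj₁
    neighbour (inj₂ (inj₁ refl)) = adj₂
    neighbour (inj₂ (inj₂ refl)) = adj₃

    involutive-neighbour : ∃[ t ] (OneOf3 n₁ n₂ n₃ t × inv t ≡ t)
    involutive-neighbour = involution-fixes-one-of-three inv ⁻¹-involutive n₁≢n₂ n₁≢n₃ n₂≢n₃
      (complete (inverse-neighbour adj₁)) (complete (inverse-neighbour adj₂))
      (complete (inverse-neighbour adj₃))

    t : Element
    t = proj₁ involutive-neighbour
    t∈N : OneOf3 n₁ n₂ n₃ t
    t∈N = proj₁ (proj₂ involutive-neighbour)

    t²≡e : t · t ≡ e
    t²≡e = trans (cong (t ·_) (sym (proj₂ (proj₂ involutive-neighbour)))) (𝔾.inverseʳ t)

    another-neighbour : ∀ {x} → OneOf3 n₁ n₂ n₃ x → ∃[ p ] (Adj C e p × p ≢ x)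
    another-neighbour (inj₁ refl)        = n₂ , adj₂ , λ eq → n₁≢n₂ (sym eq)
    another-neighbour (inj₂ (inj₁ refl)) = n₁ , adj₁ , n₁≢n₂
    another-neighbour (inj₂ (inj₂ refl)) = n₁ , adj₁ , n₁≢n₃

    p : Element
    p = proj₁ (another-neighbour t∈N)
    ep : Adj C e p
    ep = proj₁ (proj₂ (another-neighbour t∈N))
    p≢t : p ≢ t
    p≢t = proj₂ (proj₂ (another-neighbour t∈N))

-- A property of all subsets of a finite set is decidable (no subset is a counterexample).
every-subset? : ∀ {n} {Q : Subset n → Set} → (∀ A → Dec (Q A)) → Dec (∀ A → Q A)
every-subset? Q? = map′ (λ ¬∃ A → decidable-stable (Q? A) (λ ¬q → ¬∃ (A , ¬q)))
                        (λ h (A , ¬q) → ¬q (h A))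
                        (¬? (anySubset? (¬? ∘ Q?)))

every-vertex? : {P : PVertex → Set} → (∀ x → Dec (P x)) → Dec (∀ x → P x)
every-vertex? {P} P? = map′ (λ h x → h (proj₁ x) (proj₂ x)) (λ h A p → h (A , p)) (every-subset? Q?)
  where
  Q? : ∀ A → Dec (∀ (p : ∣ A ∣ ≡ 2) → P (A , p))
  Q? A with ∣ A ∣ ℕ.≟ 2
  ... | yes p = map′ (λ h q → subst (λ q → P (A , q)) (≡-irrelevant p q) h) (λ h → h p) (P? (A , p))
  ... | no ¬p = yes (λ p → ⊥-elim (¬p p))

some-vertex? : {P : PVertex → Set} → (∀ x → Dec (P x)) → Dec (∃ P)
some-vertex? {P} P? = map′ (λ (A , p , h) → (A , p) , h) (λ ((A , p) , h) → A , p , h) (anySubset? Q?)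
  where
  Q? : ∀ A → Dec (Σ (∣ A ∣ ≡ 2) λ p → P (A , p))
  Q? A with ∣ A ∣ ℕ.≟ 2
  ... | yes p = map′ (p ,_) (λ (q , h) → subst (λ q → P (A , q)) (≡-irrelevant q p) h) (P? (A , p))
  ... | no ¬p = no (λ (p , _) → ¬p p)

adjacent? : (x y : PVertex) → Dec (Adj Petersen x y)
adjacent? x y = vec-≡-dec Bool._≟_ (proj₁ x ∩ proj₁ y) ⊥

_~_ : PVertex → PVertex → Set
_~_ = Adj Petersen

petersen-loopless : Loopless Petersen
petersen-loopless = from-yes (every-vertex? λ x → ¬? (adjacent? x x))

petersen-atMostOne : AtMostOneCommonNeighbour Petersen
petersen-atMostOne {u} {v} {z} {z′} =
  from-yes (every-vertex? λ u → every-vertex? λ v → every-vertex? λ z → every-vertex? λ z′ →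
    ¬? (u ≟V v) →-dec adjacent? u z →-dec adjacent? v z →-dec
    adjacent? u z′ →-dec adjacent? v z′ →-dec z ≟V z′) u v z z′

petersen-common : NonAdjacentHaveCommonNeighbour Petersen
petersen-common {u} {v} =
  from-yes (every-vertex? λ u → every-vertex? λ v →
    ¬? (u ≟V v) →-dec ¬? (adjacent? u v) →-dec
    some-vertex? (λ z → adjacent? u z ×-dec adjacent? v z)) u v

OneOf3? : ∀ a b c x → Dec (OneOf3 a b c x)
OneOf3? a b c x = x ≟V a ⊎-dec x ≟V b ⊎-dec x ≟V c

-- Each vertex has three distinct neighbours, and no others.  Kept abstract so
-- that the exhaustive search is not re-run when the witnesses are taken apart.
abstract
  neighbourhood : ∀ x →
    ∃[ n₁ ] (x ~ n₁ × ∃[ n₂ ] (x ~ n₂ × n₁ ≢ n₂ × ∃[ n₃ ] (x ~ n₃ × n₁ ≢ n₃ × n₂ ≢ n₃ ×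
      (∀ w → x ~ w → OneOf3 n₁ n₂ n₃ w))))
  neighbourhood = from-yes (every-vertex? λ x →
    some-vertex? λ n₁ → adjacent? x n₁ ×-dec
    some-vertex? λ n₂ → adjacent? x n₂ ×-dec ¬? (n₁ ≟V n₂) ×-dec
    some-vertex? λ n₃ → adjacent? x n₃ ×-dec ¬? (n₁ ≟V n₃) ×-dec ¬? (n₂ ≟V n₃) ×-dec
    every-vertex? (λ w → adjacent? x w →-dec OneOf3? n₁ n₂ n₃ w))

petersen-cubic : Cubic Petersen
petersen-cubic x with neighbourhood x
... | n₁ , adj₁ , n₂ , adj₂ , n₁≢n₂ , n₃ , adj₃ , n₁≢n₃ , n₂≢n₃ , complete =
  threeNeighbours n₁ n₂ n₃ n₁≢n₂ n₁≢n₃ n₂≢n₃ adj₁ adj₂ adj₃ (λ {w} → complete w)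

petersenLike : PetersenLike Petersen
petersenLike = record
  { loopless = petersen-loopless ; atMostOne = petersen-atMostOne
  ; common = petersen-common ; cubic = petersen-cubic }

petersen-not-Cayley : ¬ IsCayleyGraph Petersen
petersen-not-Cayley (G , S , iso) = CayleyGraph.not-petersenLike G S (Transport.petersenLike iso petersenLike)

private
  variable
    n : ℕ

lookup-extensionality : ∀ {A : Set} {xs ys : Vec A n} → (∀ i → lookup xs i ≡ lookup ys i) → xs ≡ ys
lookup-extensionality {xs = xs} {ys} eq =
  trans (sym (tabulate∘lookup xs)) (trans (tabulate-cong eq) (tabulate∘lookup ys))

-- The subset π[A] = {π i | i ∈ A}: j belongs to it iff π⁻¹ j ∈ A.
relabel : Permutation′ n → Subset n → Subset n
relabel π A = tabulate (λ j → lookup A (π ⟨$⟩ˡ j))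

lookup-relabel : ∀ (π : Permutation′ n) A j → lookup (relabel π A) j ≡ lookup A (π ⟨$⟩ˡ j)
lookup-relabel π A = lookup∘tabulate (λ j → lookup A (π ⟨$⟩ˡ j))

relabel-inverse : ∀ (π : Permutation′ n) A → relabel (flip π) (relabel π A) ≡ A
relabel-inverse π A = lookup-extensionality λ j → begin
  lookup (relabel (flip π) (relabel π A)) j  ≡⟨ lookup-relabel (flip π) (relabel π A) j ⟩
  lookup (relabel π A) (π ⟨$⟩ʳ j)             ≡⟨ lookup-relabel π A (π ⟨$⟩ʳ j) ⟩
  lookup A (π ⟨$⟩ˡ (π ⟨$⟩ʳ j))                ≡⟨ cong (lookup A) (inverseˡ π) ⟩
  lookup A j                                  ∎
  where open ≡-Reasoning

relabel-∩ : ∀ (π : Permutation′ n) A B → relabel π (A ∩ B) ≡ relabel π A ∩ relabel π B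
relabel-∩ π A B = lookup-extensionality λ j → begin
  lookup (relabel π (A ∩ B)) j                              ≡⟨ lookup-relabel π (A ∩ B) j ⟩
  lookup (A ∩ B) (π ⟨$⟩ˡ j)                                 ≡⟨ lookup-zipWith _∧_ (π ⟨$⟩ˡ j) A B ⟩
  lookup A (π ⟨$⟩ˡ j) ∧ lookup B (π ⟨$⟩ˡ j)                 ≡⟨ sym (cong₂ _∧_ (lookup-relabel π A j) (lookup-relabel π B j)) ⟩
  lookup (relabel π A) j ∧ lookup (relabel π B) j           ≡⟨ sym (lookup-zipWith _∧_ j (relabel π A) (relabel π B)) ⟩
  lookup (relabel π A ∩ relabel π B) j                      ∎
  where open ≡-Reasoning

relabel-⊥ : ∀ (π : Permutation′ n) → relabel π ⊥ ≡ ⊥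
relabel-⊥ π = lookup-extensionality λ j →
  trans (lookup-relabel π ⊥ j) (trans (lookup-replicate (π ⟨$⟩ˡ j) false) (sym (lookup-replicate j false)))

relabel-disjoint : ∀ (π : Permutation′ n) {A B} → A ∩ B ≡ ⊥ → relabel π A ∩ relabel π B ≡ ⊥
relabel-disjoint π {A} {B} A∩B≡⊥ = trans (sym (relabel-∩ π A B)) (trans (cong (relabel π) A∩B≡⊥) (relabel-⊥ π))

indicator : Bool → ℕ
indicator b = if b then 1 else 0

size-as-sum : ∀ (A : Subset n) → ∣ A ∣ ≡ sum (λ i → indicator (lookup A i))
size-as-sum []          = refl
size-as-sum (true ∷ A)  = cong ℕ.suc (size-as-sum A)
size-as-sum (false ∷ A) = size-as-sum A

-- Relabelling preserves size, since summation is invariant under permutations.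
relabel-size : ∀ (π : Permutation′ n) A → ∣ relabel π A ∣ ≡ ∣ A ∣
relabel-size π A = begin
  ∣ relabel π A ∣                                   ≡⟨ size-as-sum (relabel π A) ⟩
  sum (λ j → indicator (lookup (relabel π A) j))    ≡⟨ sum-cong-≗ (λ j → cong indicator (lookup-relabel π A j)) ⟩
  sum (rearrange (flip π ⟨$⟩ʳ_) (λ i → indicator (lookup A i)))  ≡⟨ sym (sum-permute _ (flip π)) ⟩
  sum (λ i → indicator (lookup A i))                ≡⟨ sym (size-as-sum A) ⟩
  ∣ A ∣                                             ∎
  where open ≡-Reasoning

vertex-≡ : ∀ {x y : PVertex} → proj₁ x ≡ proj₁ y → x ≡ y
vertex-≡ {A , p} {.A , q} refl = cong (A ,_) (≡-irrelevant p q)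

relabelVertex : Permutation′ 5 → PVertex → PVertex
relabelVertex π (A , |A|≡2) = relabel π A , trans (relabel-size π A) |A|≡2

inducedAut : Permutation′ 5 → Aut Petersen
inducedAut π =
  mk↔ₛ′ (relabelVertex π) (relabelVertex (flip π))
        (λ x → vertex-≡ (relabel-inverse (flip π) (proj₁ x)))
        (λ x → vertex-≡ (relabel-inverse π (proj₁ x)))
  , λ x y → mk⇔ (relabel-disjoint π) (reflect x y)
  where
  reflect : ∀ x y → Adj Petersen (relabelVertex π x) (relabelVertex π y) → Adj Petersen x y
  reflect (A , _) (B , _) disjoint =
    subst₂ (λ A B → A ∩ B ≡ ⊥) (relabel-inverse π A) (relabel-inverse π B)
      (relabel-disjoint (flip π) disjoint)

term≤sum : ∀ {n} (M : Fin n → PVertex → PVertex → ℕ) i u v → M i u v ≤ sumMat M u v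
term≤sum M zero    u v = m≤m+n (M zero u v) _
term≤sum M (suc i) u v = ≤-trans (term≤sum (M ∘ suc) i u v) (m≤n+m _ (M zero u v))

two-terms≤sum : ∀ {n} (M : Fin n → PVertex → PVertex → ℕ) {i j} u v → i ≢ j → M i u v + M j u v ≤ sumMat M u v
two-terms≤sum M {zero}  {zero}  u v i≢j = ⊥-elim (i≢j refl)
two-terms≤sum M {zero}  {suc j} u v _   = +-monoʳ-≤ (M zero u v) (term≤sum (M ∘ suc) j u v)
two-terms≤sum M {suc i} {zero}  u v _   =
  subst (_≤ sumMat M u v) (+-comm (M zero u v) (M (suc i) u v)) (+-monoʳ-≤ (M zero u v) (term≤sum (M ∘ suc) i u v))
two-terms≤sum M {suc i} {suc j} u v i≢j =
  ≤-trans (two-terms≤sum (M ∘ suc) u v (i≢j ∘ cong suc)) (m≤n+m _ (M zero u v))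

permMatrix-graph : ∀ σ u → permMatrix σ u (Inverse.to (proj₁ σ) u) ≡ 1
permMatrix-graph σ u = cong (λ d → if ⌊ d ⌋ then 1 else 0) (proj₂ (dec-yes (σu ≟V σu) refl))
  where
  σu : PVertex
  σu = Inverse.to (proj₁ σ) u

-- Automorphisms whose permutation matrices sum to J are pairwise distinct:
-- if σᵢ = σⱼ with i ≠ j, the entry (u, σᵢ u) of the sum would be at least 2.
sum-to-J⇒distinct : ∀ {n} (σ : Fin n → Aut Petersen) → PVertex →
  (∀ u v → sumMat (λ i → permMatrix (σ i)) u v ≡ Jmat u v) →
  ∀ i j → i ≢ j → permMatrix (σ i) ≢ permMatrix (σ j)
sum-to-J⇒distinct σ u sum≡J i j i≢j σᵢ≡σⱼ = 1+n≰n (subst (2 ≤_) (sum≡J u σᵢu) two≤sum)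
  where
  σᵢu : PVertex
  σᵢu = Inverse.to (proj₁ (σ i)) u
  two≤sum : 2 ≤ sumMat (λ k → permMatrix (σ k)) u σᵢu
  two≤sum = subst (_≤ sumMat (λ k → permMatrix (σ k)) u σᵢu)
    (cong₂ _+_ (permMatrix-graph (σ i) u) (trans (cong (λ M → M u σᵢu) (sym σᵢ≡σⱼ)) (permMatrix-graph (σ i) u)))
    (two-terms≤sum (λ k → permMatrix (σ k)) u σᵢu i≢j)

affine : ℕ → ℕ → Fin 5 → Fin 5
affine a b x = (a * toℕ x + b) mod 5

slope slope⁻¹ : Fin 2 → ℕ
slope zero       = 1
slope (suc zero) = 2
slope⁻¹ zero       = 1
slope⁻¹ (suc zero) = 3

-- The inverse of x ↦ a·x + b is x ↦ a⁻¹·x − a⁻¹·b, and −1 ≡ 4 (mod 5).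
affine-inverse : Fin 2 → ℕ → Fin 5 → Fin 5
affine-inverse s b = affine (slope⁻¹ s) (4 * slope⁻¹ s * b)

affine-inverseˡ : ∀ s (b : Fin 5) x → affine (slope s) (toℕ b) (affine-inverse s (toℕ b) x) ≡ x
affine-inverseˡ = from-yes (all? λ s → all? λ (b : Fin 5) → all? λ x →
  affine (slope s) (toℕ b) (affine-inverse s (toℕ b) x) Fin.≟ x)

affine-inverseʳ : ∀ s (b : Fin 5) x → affine-inverse s (toℕ b) (affine (slope s) (toℕ b) x) ≡ x
affine-inverseʳ = from-yes (all? λ s → all? λ (b : Fin 5) → all? λ x →
  affine-inverse s (toℕ b) (affine (slope s) (toℕ b) x) Fin.≟ x)

affinePermutation : Fin 2 → Fin 5 → Permutation′ 5
affinePermutation s b =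
  permutation (affine (slope s) (toℕ b)) (affine-inverse s (toℕ b)) (affine-inverseˡ s b) (affine-inverseʳ s b)

affineAut : Fin 10 → Aut Petersen
affineAut k = inducedAut (affinePermutation (quotient {2} 5 k) (remainder {2} 5 k))

-- Each vertex u is sent to each vertex v by exactly one of them: translations
-- act transitively on each of the two orbits {i, i+1} and {i, i+2}, and the
-- doubling x ↦ 2x interchanges the orbits.
affineAut-sum≡J : ∀ u v → sumMat (λ k → permMatrix (affineAut k)) u v ≡ Jmat u v
affineAut-sum≡J = from-yes (every-vertex? λ u → every-vertex? λ v →
  sumMat (λ k → permMatrix (affineAut k)) u v ℕ.≟ 1)

vertex₀₁ : PVertex
vertex₀₁ = (true ∷ true ∷ false ∷ false ∷ false ∷ []) , refl

petersen-uniformly-vertex-transitive : PetersenUniformlyVT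
petersen-uniformly-vertex-transitive =
  affineAut , sum-to-J⇒distinct affineAut vertex₀₁ affineAut-sum≡J , affineAut-sum≡J

proposition2p7 : PetersenUniformlyVT × ¬ IsCayleyGraph Petersen
proposition2p7 = petersen-uniformly-vertex-transitive , petersen-not-Cayley
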